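{- Let $\mathcal U$ be a quantitative weak $\lambda$-theory over $\Sigma^{\mathbf{CL}}$. Then for every finite set $\Gamma$ of quantitative equations and every quantitative equation $\phi$ over $\mathbb T_{\Sigma^{\mathbf{CL}}}(\mathrm{Var})$, we have $(\Gamma\vdash\phi)\in\mathcal U$ if and only if $\Gamma\vDash_{\mathcal A}\phi$ holds for every quantitative $\Sigma^{\mathbf{CL}}$-algebra $\mathcal A$ satisfying $\mathcal U$.
   Context: Let $T$ be a set of types with a binary function $\to:T\times T\to T$. $\Sigma^{\mathbf{CL}}$ is the $T$-sorted signature consisting of binary application symbols $\cdot_{i,j}$ (arguments of sorts $i\to j$ and $i$, result of sort $j$; written infix, left-associative) and constants $\mathsf I_i:i\to i$, $\mathsf K_{ij}:i\to j\to i$, $\mathsf S_{ijk}:(i\to j\to k)\to(i\to j)\to(i\to k)$ for all $i,j,k\in T$. $\mathrm{Var}$ is a $T$-sorted set of variables, countably infinitely many of each sort, and $\mathbb T_{\Sigma^{\mathbf{CL}}}(\mathrm{Var})$ is the $T$-sorted set of terms built from variables and symbols; for a sort-preserving $f:\mathrm{Var}\to\mathbb T_{\Sigma^{\mathbf{CL}}}(\mathrm{Var})$ (or into an algebra), $f^\sharp$ is its unique homomorphic extension to terms (substitution/evaluation). A quantitative equation is $t\simeq^i_\epsilon s$ with $t,s$ terms of sort $i$ and $\epsilon\in\mathbb Q_{\ge0}$. A consequence relation is a relation $\vdash$ between sets of quantitative equations and quantitative equations closed under: (Cut) if $\Gamma\vdash\phi$ for all $\phi\in\Gamma'$ and $\Gamma'\vdash\psi$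 then $\Gamma\vdash\psi$; (Assumpt) $\phi\in\Gamma$ implies $\Gamma\vdash\phi$; (Refl) $\emptyset\vdash t\simeq_0 t$; (Symm) $\{t\simeq_\epsilon s\}\vdash s\simeq_\epsilon t$; (Triang) $\{t\simeq_\epsilon s,s\simeq_\delta u\}\vdash t\simeq_{\epsilon+\delta}u$; (Max) $\{t\simeq_\epsilon s\}\vdash t\simeq_{\epsilon+\delta}s$; (Arch) $\{t\simeq_\delta s\mid \delta>\epsilon\}\vdash t\simeq_\epsilon s$; (NExp) $\{t_1\simeq_\epsilon s_1,\dots,t_k\simeq_\epsilon s_k\}\vdash\sigma(t_1,\dots,t_k)\simeq_\epsilon\sigma(s_1,\dots,s_k)$ for each $k$-ary symbol $\sigma$; (Subst) if $\Gamma\vdash t\simeq_\epsilon s$ then $f^\sharp\Gamma\vdash f^\sharp t\simeq_\epsilon f^\sharp s$ for every substitution $f$ (all $\epsilon,\delta\in\mathbb Q_{\ge0}$, sorts matching). A basic quantitative inference is a pair (finite set of equations between variables $x\simeq_\epsilon y$, equation between terms). For a set $S$ of basic quantitative inferences, $\vdash_S$ is the least consequence relation containing $S$, and the theory generated by $S$ is $\mathcal U_S$, the set of pairs $(\Gamma,\phi)$ with $\Gamma$ finite and $\Gamma\vdash_S\phi$. A quantitative weak $\lambda$-theory is such a theory containing $\mathcal U_{\mathbf{CL}}$, the theory generated by $\emptyset\vdash\mathsf I_it\simeq_0 t$, $\emptyset\vdash\mathsf K_{ij}tu\simeq_0 t$, $\emptyset\vdash\mathsf S_{ijk}tuw\simeq_0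 tw(uw)$ for all terms of appropriate sorts. A quantitative $\Sigma^{\mathbf{CL}}$-algebra $\mathcal A$ is given by sets $A_i$ with pseudo-metrics $d_i:A_i\times A_i\to[0,\infty]$ and interpretations of the symbols as maps non-expansive w.r.t. the max-distance on products. $\Gamma\vDash_{\mathcal A}(t\simeq^i_\epsilon s)$ means: for every sort-preserving $f:\mathrm{Var}\to A$, if $d_{i'}(f^\sharp t',f^\sharp s')\le\epsilon'$ for all $(t'\simeq^{i'}_{\epsilon'}s')\in\Gamma$ then $d_i(f^\sharp t,f^\sharp s)\le\epsilon$. $\mathcal A$ satisfies $\mathcal U$ if $\Gamma\vDash_{\mathcal A}\phi$ for all $(\Gamma,\phi)\in\mathcal U$. -}

module Defs where

open import Level using (Level; _⊔_) renaming (suc to lsuc; zero to 0ℓ)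
open import Data.Nat using (ℕ)
open import Data.Rational using (ℚ; 0ℚ; _+_; _≤_; _<_)
open import Data.Rational.Properties using (+-mono-≤; ≤-refl)
open import Data.List using (List; [])
open import Data.List.Membership.Propositional using (_∈_)
open import Data.List.Relation.Unary.All using (All)
open import Data.Product using (Σ; ∃; _×_; _,_)
open import Data.Empty using (⊥)
open import Data.Sum using () renaming (_⊎_ to _⊎'_)
open import Relation.Binary.PropositionalEquality using (_≡_; subst)

record ℚ≥0 : Set where
  constructor mkℚ≥0
  field
    val    : ℚ
    nonneg : 0ℚ ≤ val
open ℚ≥0 public

0q : ℚ≥0
0q = mkℚ≥0 0ℚ ≤-refl

_+q_ : ℚ≥0 → ℚ≥0 → ℚ≥0
mkℚ≥0 p hp +q mkℚ≥0 q hq = mkℚ≥0 (p + q) (subst (_≤ p + q) (Data.Rational.Properties.+-identityʳ 0ℚ) (+-mono-≤ hp hq))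

_≤q_ : ℚ≥0 → ℚ≥0 → Set
p ≤q q = val p ≤ val q

_<q_ : ℚ≥0 → ℚ≥0 → Set
p <q q = val p < val q

module CL (T : Set) (_⇒_ : T → T → T) where

  infixl 9 _·_

  data Term : T → Set where
    var : ∀ {i} → ℕ → Term i
    _·_ : ∀ {i j} → Term (i ⇒ j) → Term i → Term j
    𝐈   : ∀ {i} → Term (i ⇒ i)
    𝐊   : ∀ {i j} → Term (i ⇒ (j ⇒ i))
    𝐒   : ∀ {i j k} → Term ((i ⇒ (j ⇒ k)) ⇒ ((i ⇒ j) ⇒ (i ⇒ k)))

  Subst : Set
  Subst = (i : T) → ℕ → Term i

  _♯ : Subst → ∀ {i} → Term i → Term i
  (f ♯) (var {i} x) = f i x
  (f ♯) (t · u)     = (f ♯) t · (f ♯) u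
  (f ♯) 𝐈           = 𝐈
  (f ♯) 𝐊           = 𝐊
  (f ♯) 𝐒           = 𝐒

  record QEq : Set where
    constructor _≃[_]_
    field
      {sort} : T
      lhs    : Term sort
      dist   : ℚ≥0
      rhs    : Term sort
  open QEq public

  substEq : Subst → QEq → QEq
  substEq f (t ≃[ ε ] s) = (f ♯) t ≃[ ε ] (f ♯) s

  EqSet : Set₁
  EqSet = QEq → Set

  ∅ : EqSet
  ∅ _ = ⊥

  ⟦_⟧ : List QEq → EqSet
  ⟦ Γ ⟧ φ = φ ∈ Γ

  _[_]ˢ : EqSet → Subst → EqSet
  (Γ [ f ]ˢ) ψ = ∃ λ φ → Γ φ × ψ ≡ substEq f φ

  Inference : Set
  Inference = List QEq × QEq

  IsVar : ∀ {i} → Term i → Set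
  IsVar t = ∃ λ x → t ≡ var x

  IsBasic : Inference → Set
  IsBasic (Δ , φ) = All (λ e → IsVar (lhs e) × IsVar (rhs e)) Δ

  data _⊢[_]_ : EqSet → (Inference → Set) → QEq → Set₁ where
    ax      : ∀ {S Δ φ} → S (Δ , φ) → ⟦ Δ ⟧ ⊢[ S ] φ
    cut     : ∀ {S Γ ψ} (Γ' : EqSet) →
              (∀ φ → Γ' φ → Γ ⊢[ S ] φ) → Γ' ⊢[ S ] ψ → Γ ⊢[ S ] ψ
    assumpt : ∀ {S Γ φ} → Γ φ → Γ ⊢[ S ] φ
    refl'   : ∀ {S i} (t : Term i) → ∅ ⊢[ S ] (t ≃[ 0q ] t)
    symm    : ∀ {S i} (t s : Term i) ε →
              (λ ψ → ψ ≡ (t ≃[ ε ] s)) ⊢[ S ] (s ≃[ ε ] t)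
    triang  : ∀ {S i} (t s u : Term i) ε δ →
              (λ ψ → ψ ≡ (t ≃[ ε ] s) ⊎' ψ ≡ (s ≃[ δ ] u)) ⊢[ S ] (t ≃[ ε +q δ ] u)
    max     : ∀ {S i} (t s : Term i) ε δ →
              (λ ψ → ψ ≡ (t ≃[ ε ] s)) ⊢[ S ] (t ≃[ ε +q δ ] s)
    arch    : ∀ {S i} (t s : Term i) ε →
              (λ ψ → ∃ λ δ → ε <q δ × ψ ≡ (t ≃[ δ ] s)) ⊢[ S ] (t ≃[ ε ] s)
    nexp-·  : ∀ {S i j} (t₁ s₁ : Term (i ⇒ j)) (t₂ s₂ : Term i) ε →
              (λ ψ → ψ ≡ (t₁ ≃[ ε ] s₁) ⊎' ψ ≡ (t₂ ≃[ ε ] s₂))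
                ⊢[ S ] ((t₁ · t₂) ≃[ ε ] (s₁ · s₂))
    nexp-𝐈  : ∀ {S i} ε → ∅ ⊢[ S ] (𝐈 {i} ≃[ ε ] 𝐈)
    nexp-𝐊  : ∀ {S i j} ε → ∅ ⊢[ S ] (𝐊 {i} {j} ≃[ ε ] 𝐊)
    nexp-𝐒  : ∀ {S i j k} ε → ∅ ⊢[ S ] (𝐒 {i} {j} {k} ≃[ ε ] 𝐒)
    subst'  : ∀ {S Γ φ} (f : Subst) → Γ ⊢[ S ] φ → (Γ [ f ]ˢ) ⊢[ S ] substEq f φ

  𝒰 : (Inference → Set) → List QEq → QEq → Set₁
  𝒰 S Γ φ = ⟦ Γ ⟧ ⊢[ S ] φ

  data CLAx : Inference → Set where
    I-ax : ∀ {i} (t : Term i) → CLAx ([] , ((𝐈 · t) ≃[ 0q ] t))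
    K-ax : ∀ {i j} (t : Term i) (u : Term j) → CLAx ([] , ((𝐊 · t · u) ≃[ 0q ] t))
    S-ax : ∀ {i j k} (t : Term (i ⇒ (j ⇒ k))) (u : Term (i ⇒ j)) (w : Term i) →
           CLAx ([] , ((𝐒 · t · u · w) ≃[ 0q ] (t · w · (u · w))))

  record QAlg (ℓ : Level) : Set (lsuc ℓ) where
    field
      A     : T → Set ℓ
      d≤    : ∀ {i} → A i → A i → ℚ≥0 → Set ℓ
      -- d is a well-defined element of [0,∞]: upward closed and closed (Archimedean)
      up    : ∀ {i} {a b : A i} {ε δ} → d≤ a b ε → ε ≤q δ → d≤ a b δ
      closed : ∀ {i} {a b : A i} {ε} → (∀ δ → ε <q δ → d≤ a b δ) → d≤ a b ε
      d-refl : ∀ {i} (a : A i) → d≤ a a 0q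
      d-sym  : ∀ {i} {a b : A i} {ε} → d≤ a b ε → d≤ b a ε
      d-tri  : ∀ {i} {a b c : A i} {ε δ} → d≤ a b ε → d≤ b c δ → d≤ a c (ε +q δ)
      app   : ∀ {i j} → A (i ⇒ j) → A i → A j
      I     : ∀ {i} → A (i ⇒ i)
      K     : ∀ {i j} → A (i ⇒ (j ⇒ i))
      S     : ∀ {i j k} → A ((i ⇒ (j ⇒ k)) ⇒ ((i ⇒ j) ⇒ (i ⇒ k)))
      -- application is non-expansive w.r.t. the max-distance on A(i⇒j)×A(i)
      -- (constants are trivially non-expansive by d-refl and up)
      app-nexp : ∀ {i j} {f g : A (i ⇒ j)} {a b : A i} {ε} →
                 d≤ f g ε → d≤ a b ε → d≤ (app f a) (app g b) ε

  module _ {ℓ} (𝒜 : QAlg ℓ) where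
    open QAlg 𝒜

    Assignment : Set ℓ
    Assignment = (i : T) → ℕ → A i

    eval : Assignment → ∀ {i} → Term i → A i
    eval f (var {i} x) = f i x
    eval f (t · u)     = app (eval f t) (eval f u)
    eval f 𝐈           = I
    eval f 𝐊           = K
    eval f 𝐒           = S

    Holds : Assignment → QEq → Set ℓ
    Holds f (t ≃[ ε ] s) = d≤ (eval f t) (eval f s) ε

    _⊨_ : List QEq → QEq → Set ℓ
    Γ ⊨ φ = ∀ (f : Assignment) → (∀ ψ → ψ ∈ Γ → Holds f ψ) → Holds f φ

  Satisfies : ∀ {ℓ ℓ'} → QAlg ℓ → (List QEq → QEq → Set ℓ') → Set (ℓ ⊔ ℓ')
  Satisfies 𝒜 U = ∀ Γ φ → U Γ φ → _⊨_ 𝒜 Γ φ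

module Submission where

open import Defs
open import Level using (Level; _⊔_; Lift; lift; lower) renaming (suc to lsuc; zero to 0ℓ)
open import Data.List using (List)
open import Data.Product using (Σ; _,_)
open import Data.Sum using (_⊎_; inj₁; inj₂)
open import Data.List.Membership.Propositional using (_∈_)
open import Function.Bundles using (_⇔_; mk⇔)
open import Relation.Binary.PropositionalEquality
  using (_≡_; refl; sym; cong; cong₂; subst; module ≡-Reasoning)
open import Data.Rational using (0ℚ; _+_; _-_; -_; _≤_)
import Data.Rational.Properties as ℚ

-- Term-model completeness: interpret each sort by its terms, with d(t, s) ≤ ε meaning
-- that Γ ⊢_S t ≃_ε s.  The closure rules of ⊢_S make this a quantitative algebra, Subst
-- makes it satisfy 𝒰_S, and evaluating under the assignment of every variable to itself
-- turns Γ ⊨ φ into Γ ⊢_S φ.  Soundness is immediate, since 𝒰_S contains (Γ, φ).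

mkℚ≥0-cong : ∀ {p q} (p≡q : p ≡ q) (0≤p : 0ℚ ≤ p) (0≤q : 0ℚ ≤ q) → mkℚ≥0 p 0≤p ≡ mkℚ≥0 q 0≤q
mkℚ≥0-cong refl 0≤p 0≤q = cong (mkℚ≥0 _) (ℚ.≤-irrelevant 0≤p 0≤q)

≤q⇒∃+q≡ : ∀ ε δ → ε ≤q δ → Σ ℚ≥0 (λ η → ε +q η ≡ δ)
≤q⇒∃+q≡ (mkℚ≥0 e 0≤e) (mkℚ≥0 d 0≤d) e≤d = mkℚ≥0 (d - e) 0≤d-e , mkℚ≥0-cong e+[d-e]≡d _ _
  where
  0≤d-e : 0ℚ ≤ d - e
  0≤d-e = subst (_≤ d - e) (ℚ.+-inverseʳ e) (ℚ.+-monoˡ-≤ (- e) e≤d)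
  e+[d-e]≡d : e + (d - e) ≡ d
  e+[d-e]≡d = begin
    e + (d - e)   ≡⟨ cong (e +_) (ℚ.+-comm d (- e)) ⟩
    e + (- e + d) ≡⟨ ℚ.+-assoc e (- e) d ⟨
    e - e + d     ≡⟨ cong (_+ d) (ℚ.+-inverseʳ e) ⟩
    0ℚ + d        ≡⟨ ℚ.+-identityˡ d ⟩
    d             ∎
    where open ≡-Reasoning

module _ (T : Set) (_⇒_ : T → T → T) where
  open CL T _⇒_

  ♯-identity : ∀ {i} (t : Term i) → ((λ _ → var) ♯) t ≡ t
  ♯-identity (var x) = refl
  ♯-identity (t · u) = cong₂ _·_ (♯-identity t) (♯-identity u)
  ♯-identity 𝐈       = refl
  ♯-identity 𝐊       = refl
  ♯-identity 𝐒       = refl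

  substEq-identity : ∀ φ → substEq (λ _ → var) φ ≡ φ
  substEq-identity (t ≃[ ε ] s) = cong₂ (_≃[ ε ]_) (♯-identity t) (♯-identity s)

  module _ {S : Inference → Set} {Γ : EqSet} where

    weaken-∅ : ∀ {ψ} → ∅ ⊢[ S ] ψ → Γ ⊢[ S ] ψ
    weaken-∅ = cut ∅ (λ _ ())

    cut₁ : ∀ {φ ψ} → Γ ⊢[ S ] φ → (λ χ → χ ≡ φ) ⊢[ S ] ψ → Γ ⊢[ S ] ψ
    cut₁ ⊢φ = cut _ λ { _ refl → ⊢φ }

    cut₂ : ∀ {φ φ′ ψ} → Γ ⊢[ S ] φ → Γ ⊢[ S ] φ′ →
           (λ χ → χ ≡ φ ⊎ χ ≡ φ′) ⊢[ S ] ψ → Γ ⊢[ S ] ψ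
    cut₂ ⊢φ ⊢φ′ = cut _ λ { _ (inj₁ refl) → ⊢φ ; _ (inj₂ refl) → ⊢φ′ }

    ⊢-mono : ∀ {i} {t s : Term i} {ε δ} → Γ ⊢[ S ] (t ≃[ ε ] s) → ε ≤q δ → Γ ⊢[ S ] (t ≃[ δ ] s)
    ⊢-mono {t = t} {s} {ε} {δ} ⊢t≃s ε≤δ with ≤q⇒∃+q≡ ε δ ε≤δ
    ... | η , refl = cut₁ ⊢t≃s (max t s ε η)

    ⊢-closed : ∀ {i} {t s : Term i} {ε} →
               (∀ δ → ε <q δ → Γ ⊢[ S ] (t ≃[ δ ] s)) → Γ ⊢[ S ] (t ≃[ ε ] s)
    ⊢-closed {t = t} {s} {ε} ⊢t≃s = cut _ (λ { _ (δ , ε<δ , refl) → ⊢t≃s δ ε<δ }) (arch t s ε)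

    ⊢-refl : ∀ {i} (t : Term i) → Γ ⊢[ S ] (t ≃[ 0q ] t)
    ⊢-refl t = weaken-∅ (refl' t)

    ⊢-sym : ∀ {i} {t s : Term i} {ε} → Γ ⊢[ S ] (t ≃[ ε ] s) → Γ ⊢[ S ] (s ≃[ ε ] t)
    ⊢-sym {t = t} {s} {ε} ⊢t≃s = cut₁ ⊢t≃s (symm t s ε)

    ⊢-trans : ∀ {i} {t s u : Term i} {ε δ} →
              Γ ⊢[ S ] (t ≃[ ε ] s) → Γ ⊢[ S ] (s ≃[ δ ] u) → Γ ⊢[ S ] (t ≃[ ε +q δ ] u)
    ⊢-trans {t = t} {s} {u} {ε} {δ} ⊢t≃s ⊢s≃u = cut₂ ⊢t≃s ⊢s≃u (triang t s u ε δ)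

    ⊢-· : ∀ {i j} {t s : Term (i ⇒ j)} {u w : Term i} {ε} →
          Γ ⊢[ S ] (t ≃[ ε ] s) → Γ ⊢[ S ] (u ≃[ ε ] w) → Γ ⊢[ S ] ((t · u) ≃[ ε ] (s · w))
    ⊢-· {t = t} {s} {u} {w} {ε} ⊢t≃s ⊢u≃w = cut₂ ⊢t≃s ⊢u≃w (nexp-· t s u w ε)

  module TermModel (ℓ : Level) (S : Inference → Set) (Γ : List QEq) where

    termAlgebra : QAlg (lsuc 0ℓ ⊔ ℓ)
    termAlgebra = record
      { A        = λ i → Lift (lsuc 0ℓ ⊔ ℓ) (Term i)
      ; d≤       = λ t s ε → Lift ℓ (⟦ Γ ⟧ ⊢[ S ] (lower t ≃[ ε ] lower s))
      ; up       = λ ⊢t≃s ε≤δ → lift (⊢-mono (lower ⊢t≃s) ε≤δ)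
      ; closed   = λ ⊢t≃s → lift (⊢-closed (λ δ ε<δ → lower (⊢t≃s δ ε<δ)))
      ; d-refl   = λ t → lift (⊢-refl (lower t))
      ; d-sym    = λ ⊢t≃s → lift (⊢-sym (lower ⊢t≃s))
      ; d-tri    = λ ⊢t≃s ⊢s≃u → lift (⊢-trans (lower ⊢t≃s) (lower ⊢s≃u))
      ; app      = λ t u → lift (lower t · lower u)
      ; I        = lift 𝐈
      ; K        = lift 𝐊
      ; S        = lift 𝐒
      ; app-nexp = λ ⊢t≃s ⊢u≃w → lift (⊢-· (lower ⊢t≃s) (lower ⊢u≃w))
      }

    toSubst : Assignment termAlgebra → Subst
    toSubst f i x = lower (f i x)

    eval≡♯ : ∀ (f : Assignment termAlgebra) {i} (t : Term i) →
             lower (eval termAlgebra f t) ≡ (toSubst f ♯) t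
    eval≡♯ f (var x) = refl
    eval≡♯ f (t · u) = cong₂ _·_ (eval≡♯ f t) (eval≡♯ f u)
    eval≡♯ f 𝐈       = refl
    eval≡♯ f 𝐊       = refl
    eval≡♯ f 𝐒       = refl

    Holds≡⊢ : ∀ f φ → Holds termAlgebra f φ ≡ Lift ℓ (⟦ Γ ⟧ ⊢[ S ] substEq (toSubst f) φ)
    Holds≡⊢ f (t ≃[ ε ] s) = cong₂ (λ t′ s′ → Lift ℓ (⟦ Γ ⟧ ⊢[ S ] (t′ ≃[ ε ] s′)))
                                   (eval≡♯ f t) (eval≡♯ f s)

    Holds⇒⊢ : ∀ f φ → Holds termAlgebra f φ → ⟦ Γ ⟧ ⊢[ S ] substEq (toSubst f) φ
    Holds⇒⊢ f φ holds = lower (subst (λ X → X) (Holds≡⊢ f φ) holds)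

    ⊢⇒Holds : ∀ f φ → ⟦ Γ ⟧ ⊢[ S ] substEq (toSubst f) φ → Holds termAlgebra f φ
    ⊢⇒Holds f φ ⊢φ = subst (λ X → X) (sym (Holds≡⊢ f φ)) (lift ⊢φ)

    termAlgebra-satisfies : Satisfies termAlgebra (𝒰 S)
    termAlgebra-satisfies Δ φ Δ⊢φ f Δ-holds = ⊢⇒Holds f φ
      (cut (⟦ Δ ⟧ [ toSubst f ]ˢ) (λ { _ (ψ , ψ∈Δ , refl) → Holds⇒⊢ f ψ (Δ-holds ψ ψ∈Δ) })
           (subst' (toSubst f) Δ⊢φ))

    identityAssignment : Assignment termAlgebra
    identityAssignment i x = lift (var x)

    ⊨⇒⊢ : ∀ φ → _⊨_ termAlgebra Γ φ → ⟦ Γ ⟧ ⊢[ S ] φ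
    ⊨⇒⊢ φ Γ⊨φ = subst (⟦ Γ ⟧ ⊢[ S ]_) (substEq-identity φ)
                      (Holds⇒⊢ identityAssignment φ (Γ⊨φ identityAssignment Γ-holds))
      where
      Γ-holds : ∀ ψ → ψ ∈ Γ → Holds termAlgebra identityAssignment ψ
      Γ-holds ψ ψ∈Γ = ⊢⇒Holds identityAssignment ψ
        (subst (⟦ Γ ⟧ ⊢[ S ]_) (sym (substEq-identity ψ)) (assumpt ψ∈Γ))

mainTheorem3 : (T : Set) (_⇒_ : T → T → T) (ℓ : Level) →
    let open CL T _⇒_ in
    (S : Inference → Set) →
    (∀ p → S p → IsBasic p) →
    (∀ Γ φ → 𝒰 CLAx Γ φ → 𝒰 S Γ φ) →
    (Γ : List QEq) (φ : QEq) →
    𝒰 S Γ φ ⇔ (∀ (𝒜 : QAlg (lsuc 0ℓ ⊔ ℓ)) → Satisfies 𝒜 (𝒰 S) → _⊨_ 𝒜 Γ φ)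
mainTheorem3 T _⇒_ ℓ S _ _ Γ φ =
  mk⇔ (λ Γ⊢φ 𝒜 𝒜⊨𝒰 → 𝒜⊨𝒰 Γ φ Γ⊢φ)
      (λ ⊨φ → ⊨⇒⊢ φ (⊨φ termAlgebra termAlgebra-satisfies))
  where open TermModel T _⇒_ ℓ S Γ
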